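{- For every $k\ge1$ there exists a TRS $\mathcal{R}_k$ over the constructors $\mathsf{s}$ (unary) and $0$ (constant), defining a single defined symbol $\mathsf{f}_k$, such that $\mathcal{R}_k\subseteq{>_{\mathsf{pop*}}}$ (for some safe mapping and admissible precedence) and $\mathrm{rc}_{\mathcal{R}_k}(n)=\Omega(n^k)$.
   Context: Terms over a finite signature of defined symbols and constructors; basic terms are $f(v_1..v_n)$ with $f$ defined and $v_i$ built from constructors and variables. The innermost runtime complexity $\mathrm{rc}_{\mathcal{R}}(n)$ is the maximal length of an innermost rewrite sequence (redex arguments in normal form) starting from a basic term of size at most $n$ (size = number of symbol and variable occurrences). $>_{\mathsf{pop*}}$: given a safe mapping (each symbol has a set of safe argument positions, all safe for constructors; write $f(s_1..s_k;s_{k+1}..s_{k+l})$ with the first $k$ normal) and an admissible precedence (preorder $\succsim$ with strict part $\succ$ and equivalence $\sim$ only relating two defined or two constructor symbols); $s\approx t$ iff $s=t$ or $s=f(\vec s)$, $t=g(\vec t)$, $f\sim g$ with a permutation $\pi$, $s_i\approx t_{\pi(i)}$, preserving normal/safe status; $\mathcal{T}(\mathcal{F}_{<f},\mathcal{V})$: terms over variables and symbols below $f$. For $s=f(s_1..s_{k+l})$: $s>_{\mathsf{sq}}t$ iff $s_i(>_{\mathsf{sq}}\cup\approx)t$ for some $i$ (normal if $f$ defined) or $f$ defined, $t=g(t_1..t_p)$, $f\succ g$, $s>_{\mathsf{sq}}t_i$ for all $i$. $s>_{\mathsf{pop*}}t$ iff (1) $s_i\ge_{\mathsf{pop*}}t$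 for some $i$; (2) $f$ defined, $t=g(t_1..t_m;t_{m+1}..t_{m+n})$, $f\succ g$, $s>_{\mathsf{sq}}t_j$ for normal $j$, $s>_{\mathsf{pop*}}t_j$ for safe $j$, at most one safe $t_j\notin\mathcal{T}(\mathcal{F}_{<f},\mathcal{V})$; or (3) $f$ defined, $f\sim g$, normal arguments decrease in the strict and safe arguments in the weak multiset extension of $>_{\mathsf{pop*}}$ (modulo $\approx$); $\ge_{\mathsf{pop*}}={>_{\mathsf{pop*}}}\cup\approx$. $\mathcal{R}\subseteq{>_{\mathsf{pop*}}}$ means $l>_{\mathsf{pop*}}r$ for every rule. -}

module Defs where

open import Data.Nat using (ℕ; zero; suc; _+_; _*_; _^_; _≤_)
open import Data.Bool using (Bool; true; false; not)
open import Data.Fin using (Fin)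
open import Data.Vec using (Vec; []; _∷_; lookup; _[_]≔_)
open import Data.List using (List; []; _∷_; _++_; map; filterᵇ; allFin)
open import Data.List.Relation.Unary.All using (All)
open import Data.List.Relation.Unary.Any using (Any)
open import Data.List.Relation.Binary.Pointwise using (Pointwise)
open import Data.List.Relation.Binary.Permutation.Propositional using (_↭_)
open import Data.List.Membership.Propositional using (_∈_)
open import Data.Product using (Σ; ∃; ∃-syntax; _×_; _,_)
open import Data.Sum using (_⊎_)
open import Data.Unit using (⊤)
open import Relation.Nullary using (¬_)
open import Relation.Binary.PropositionalEquality using (_≡_; _≢_)
open import Function.Bundles using (_↔_; Inverse)

record Signature : Set₁ where
  field
    Sym       : Set
    arity     : Sym → ℕ
    isDefined : Sym → Bool

module Terms (Sig : Signature) where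
  open Signature Sig

  data Term : Set where
    var : ℕ → Term
    app : (f : Sym) → Vec Term (arity f) → Term

  mutual
    size : Term → ℕ
    size (var x)    = 1
    size (app f ts) = suc (sizes ts)

    sizes : ∀ {n} → Vec Term n → ℕ
    sizes []       = 0
    sizes (t ∷ ts) = size t + sizes ts

  Subst : Set
  Subst = ℕ → Term

  mutual
    _⟨_⟩ : Term → Subst → Term
    var x    ⟨ σ ⟩ = σ x
    app f ts ⟨ σ ⟩ = app f (ts ⟨ σ ⟩*)

    _⟨_⟩* : ∀ {n} → Vec Term n → Subst → Vec Term n
    []       ⟨ σ ⟩* = []
    (t ∷ ts) ⟨ σ ⟩* = (t ⟨ σ ⟩) ∷ (ts ⟨ σ ⟩*)

  data Occurs (x : ℕ) : Term → Set where
    here  : Occurs x (var x)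
    below : ∀ {f ts} (i : Fin (arity f)) → Occurs x (lookup ts i) → Occurs x (app f ts)

  data ConstrTerm : Term → Set where
    cvar : ∀ {x} → ConstrTerm (var x)
    capp : ∀ {g ts} → isDefined g ≡ false →
           (∀ i → ConstrTerm (lookup ts i)) → ConstrTerm (app g ts)

  data Basic : Term → Set where
    basic : ∀ {f ts} → isDefined f ≡ true →
            (∀ i → ConstrTerm (lookup ts i)) → Basic (app f ts)

  record Rule : Set where
    constructor _⇒_∣_∣_
    field
      lhs        : Term
      rhs        : Term
      lhsDefined : ∃[ f ] ∃[ ts ] (lhs ≡ app f ts × isDefined f ≡ true)
      varsIncl   : ∀ x → Occurs x rhs → Occurs x lhs
  open Rule public

  TRS : Set
  TRS = List Rule

  module _ (R : TRS) where

    data _⟶_ : Term → Term → Set where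
      root : ∀ {ρ} (σ : Subst) → ρ ∈ R → (lhs ρ ⟨ σ ⟩) ⟶ (rhs ρ ⟨ σ ⟩)
      arg  : ∀ {f ts u} (i : Fin (arity f)) → lookup ts i ⟶ u →
             app f ts ⟶ app f (ts [ i ]≔ u)

    NF : Term → Set
    NF t = ∀ u → ¬ (t ⟶ u)

    ArgsNF : Term → Set
    ArgsNF (var x)    = ⊤
    ArgsNF (app f ts) = ∀ i → NF (lookup ts i)

    data _⟶ᵢ_ : Term → Term → Set where
      root : ∀ {ρ} (σ : Subst) → ρ ∈ R → ArgsNF (lhs ρ ⟨ σ ⟩) →
             (lhs ρ ⟨ σ ⟩) ⟶ᵢ (rhs ρ ⟨ σ ⟩)
      arg  : ∀ {f ts u} (i : Fin (arity f)) → lookup ts i ⟶ᵢ u →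
             app f ts ⟶ᵢ app f (ts [ i ]≔ u)

    data InnermostSeq : ℕ → Term → Term → Set where
      done : ∀ {t} → InnermostSeq 0 t t
      step : ∀ {m s t u} → s ⟶ᵢ t → InnermostSeq m t u → InnermostSeq (suc m) s u

    -- rc_R(n) ≥ m : some basic term of size ≤ n starts an innermost
    -- rewrite sequence of length m
    rc≥ : ℕ → ℕ → Set
    rc≥ n m = ∃[ t ] (Basic t × size t ≤ n × ∃[ u ] InnermostSeq m t u)

    rcΩ : ℕ → Set
    rcΩ k = ∃[ c ] ∃[ N ] (∀ n → N ≤ n → ∃[ m ] (n ^ k ≤ c * m × rc≥ n m))

record SafeMapping (Sig : Signature) : Set where
  open Signature Sig
  field
    safe            : (f : Sym) → Fin (arity f) → Bool
    constructorSafe : ∀ f i → isDefined f ≡ false → safe f i ≡ true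

record Precedence (Sig : Signature) : Set₁ where
  open Signature Sig
  field
    _≿_        : Sym → Sym → Set
    ≿-refl     : ∀ f → f ≿ f
    ≿-trans    : ∀ {f g h} → f ≿ g → g ≿ h → f ≿ h
    admissible : ∀ {f g} → f ≿ g → g ≿ f → isDefined f ≡ isDefined g

module POP (Sig : Signature) (SM : SafeMapping Sig) (P : Precedence Sig) where
  open Signature Sig
  open Terms Sig
  open SafeMapping SM
  open Precedence P

  _≻_ : Sym → Sym → Set
  f ≻ g = f ≿ g × ¬ (g ≿ f)

  _∼_ : Sym → Sym → Set
  f ∼ g = f ≿ g × g ≿ f

  data _≈_ : Term → Term → Set where
    ≈refl : ∀ {t} → t ≈ t
    ≈perm : ∀ {f g ss ts} → f ∼ g → (π : Fin (arity f) ↔ Fin (arity g)) →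
            (∀ i → safe f i ≡ safe g (Inverse.to π i)) →
            (∀ i → lookup ss i ≈ lookup ts (Inverse.to π i)) →
            app f ss ≈ app g ts

  data Below (f : Sym) : Term → Set where
    bvar : ∀ {x} → Below f (var x)
    bapp : ∀ {g ts} → f ≻ g → (∀ i → Below f (lookup ts i)) → Below f (app g ts)

  normalArgs : (f : Sym) → Vec Term (arity f) → List Term
  normalArgs f ts = map (lookup ts) (filterᵇ (λ i → not (safe f i)) (allFin (arity f)))

  safeArgs : (f : Sym) → Vec Term (arity f) → List Term
  safeArgs f ts = map (lookup ts) (filterᵇ (λ i → safe f i) (allFin (arity f)))

  -- multiset extensions (Dershowitz–Manna) of a relation, modulo ≈
  data MulGe (_>_ : Term → Term → Set) (M N : List Term) : Set where
    mulGe : (X Y X' Z : List Term) → M ↭ X ++ Y → N ↭ X' ++ Z →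
            Pointwise _≈_ X X' → All (λ z → Any (λ y → y > z) Y) Z →
            MulGe _>_ M N

  data MulGt (_>_ : Term → Term → Set) (M N : List Term) : Set where
    mulGt : (X Y X' Z : List Term) → M ↭ X ++ Y → N ↭ X' ++ Z →
            Pointwise _≈_ X X' → Y ≢ [] → All (λ z → Any (λ y → y > z) Y) Z →
            MulGt _>_ M N

  data _>sq_ : Term → Term → Set where
    sq-sub  : ∀ {f ss t} (i : Fin (arity f)) →
              (isDefined f ≡ true → safe f i ≡ false) →
              (lookup ss i >sq t ⊎ lookup ss i ≈ t) → app f ss >sq t
    sq-prec : ∀ {f ss g ts} → isDefined f ≡ true → f ≻ g →
              (∀ j → app f ss >sq lookup ts j) → app f ss >sq app g ts

  data _>pop*_ : Term → Term → Set where
    pop-sub  : ∀ {f ss t} (i : Fin (arity f)) →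
               (lookup ss i >pop* t ⊎ lookup ss i ≈ t) → app f ss >pop* t
    pop-prec : ∀ {f ss g ts} → isDefined f ≡ true → f ≻ g →
               (∀ j → safe g j ≡ false → app f ss >sq lookup ts j) →
               (∀ j → safe g j ≡ true → app f ss >pop* lookup ts j) →
               (∀ j j' → safe g j ≡ true → safe g j' ≡ true →
                  ¬ Below f (lookup ts j) → ¬ Below f (lookup ts j') → j ≡ j') →
               app f ss >pop* app g ts
    pop-eq   : ∀ {f ss g ts} → isDefined f ≡ true → f ∼ g →
               MulGt _>pop*_ (normalArgs f ss) (normalArgs g ts) →
               MulGe _>pop*_ (safeArgs f ss) (safeArgs g ts) →
               app f ss >pop* app g ts

  _≥pop*_ : Term → Term → Set
  s ≥pop* t = s >pop* t ⊎ s ≈ t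

  Compatible : TRS → Set
  Compatible R = ∀ {ρ} → ρ ∈ R → lhs ρ >pop* rhs ρ

data SymSF : Set where
  𝟎 𝐬 𝐟 : SymSF

SigSF : ℕ → Signature
SigSF a = record { Sym = SymSF ; arity = ar ; isDefined = def }
  where
    ar : SymSF → ℕ
    ar 𝟎 = 0
    ar 𝐬 = 1
    ar 𝐟 = a
    def : SymSF → Bool
    def 𝐟 = true
    def _ = false

-- The TRS has, for every position j < k, the rule
--     f(x₀,…,x_{j-1}, s(x_j), 0,…,0)  →  f(x₀,…,x_{j-1}, x_j, x_j,…,x_j).
-- All argument positions of f are normal and f ∼ f, so each rule is oriented by
-- the multiset case of >pop*: the argument s(x_j) is replaced by copies of the
-- smaller x_j.  Started on f(v,…,v), the rules act like k nested countdown
-- loops; the number of steps `steps k v` satisfies a simple recurrence and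
-- grows like v^k, while the start term only has size O(v).
module Submission where

open import Defs
open import Data.Nat using (ℕ; _≤_)
open import Data.Product using (Σ; ∃-syntax; _×_)

open import Data.Nat using (zero; suc; _+_; _*_; _^_; _<_; z≤n; s≤s; NonZero; _/_; _%_; >-nonZero)
open import Data.Nat.Properties
open import Data.Nat.DivMod using (m≡m%n+[m/n]*n; m%n<n; m/n*n≤m; m≥n⇒m/n>0)
open import Data.Bool using (Bool; true; false; not)
open import Data.Fin as Fin using (Fin; toℕ; fromℕ<)
open import Data.Fin.Properties using (toℕ-fromℕ<; toℕ<n)
open import Data.Vec as Vec using (Vec; []; _∷_; lookup; toList)
open import Data.Vec.Properties using (toList-replicate)
open import Data.List as List using (List; _++_; filterᵇ; allFin)
open import Data.List.Properties using (map-tabulate)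
open import Data.List.Membership.Propositional using (_∈_)
open import Data.List.Membership.Propositional.Properties using (∈-map⁺; ∈-map⁻; ∈-allFin)
open import Data.List.Relation.Unary.All as All using (All)
open import Data.List.Relation.Unary.All.Properties using (replicate⁺)
open import Data.List.Relation.Unary.Any using (here)
import Data.List.Relation.Binary.Pointwise as Pointwise
open import Data.List.Relation.Binary.Permutation.Propositional using (↭-reflexive)
open import Data.Product using (_,_)
open import Data.Sum using (inj₁; inj₂)
open import Data.Unit using (⊤; tt)
open import Data.Empty using (⊥)
open import Relation.Binary.PropositionalEquality
open import Data.Nat.Tactic.RingSolver using (solve-∀)

^-distribʳ-* : ∀ x y k → (x * y) ^ k ≡ x ^ k * y ^ k
^-distribʳ-* x y zero    = refl
^-distribʳ-* x y (suc k) = begin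
  x * y * (x * y) ^ k       ≡⟨ cong (x * y *_) (^-distribʳ-* x y k) ⟩
  x * y * (x ^ k * y ^ k)   ≡⟨ interchange x y (x ^ k) (y ^ k) ⟩
  x * x ^ k * (y * y ^ k)   ∎
  where
    open ≡-Reasoning
    interchange : ∀ x y X Y → x * y * (X * Y) ≡ x * X * (y * Y)
    interchange = solve-∀

filterᵇ-all : ∀ {A : Set} (p : A → Bool) → (∀ x → p x ≡ true) →
  ∀ xs → filterᵇ p xs ≡ xs
filterᵇ-all p all-true List.[] = refl
filterᵇ-all p all-true (x List.∷ xs) rewrite all-true x =
  cong (x List.∷_) (filterᵇ-all p all-true xs)

filterᵇ-none : ∀ {A : Set} (p : A → Bool) → (∀ x → p x ≡ false) →
  ∀ xs → filterᵇ p xs ≡ List.[]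
filterᵇ-none p all-false List.[] = refl
filterᵇ-none p all-false (x List.∷ xs) rewrite all-false x =
  filterᵇ-none p all-false xs

tabulate-lookup : ∀ {A : Set} {n} (ts : Vec A n) → List.tabulate (lookup ts) ≡ toList ts
tabulate-lookup []       = refl
tabulate-lookup (t ∷ ts) = cong (t List.∷_) (tabulate-lookup ts)

module Rewriting (Sig : Signature) where
  open Signature Sig
  open Terms Sig

  -- A constructor term contains no redex, because every left-hand side has a
  -- defined root symbol.  This makes constructor arguments innermost-normal.
  constr-NF : ∀ (R : TRS) {t} → ConstrTerm t → NF R t
  constr-NF R c           _ (root {ρ} σ _) = lhs-not-constr (lhsDefined ρ) c
    where
      lhs-not-constr : ∀ {l} → ∃[ f ] ∃[ ts ] (l ≡ app f ts × isDefined f ≡ true) →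
                       ConstrTerm (l ⟨ σ ⟩) → ⊥
      lhs-not-constr (f , ts , refl , f-def) (capp f-con _) with trans (sym f-def) f-con
      ... | ()
  constr-NF R (capp _ cs) _ (arg i st)     = constr-NF R (cs i) _ st

  _++ˢ_ : ∀ {R p q s t u} → InnermostSeq R p s t → InnermostSeq R q t u →
          InnermostSeq R (p + q) s u
  done      ++ˢ rest = rest
  step st d ++ˢ rest = step st (d ++ˢ rest)

  rc≥-mono : ∀ {R n n' L} → n ≤ n' → rc≥ R n L → rc≥ R n' L
  rc≥-mono n≤n' (t , b , size≤n , d) = t , b , ≤-trans size≤n n≤n' , d

  -- If for every m ≥ 1 some basic term of size ≤ K·m starts an innermost
  -- derivation of length L with m^k ≤ 2L, then rc_R(n) = Ω(n^k): for n ≥ K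
  -- take m = n / K, so that K·m ≤ n ≤ 2K·m.
  rcΩ-fromLinearFamily : ∀ (R : TRS) k K .{{_ : NonZero K}} →
    (∀ m → 1 ≤ m → ∃[ L ] (m ^ k ≤ 2 * L × rc≥ R (K * m) L)) → rcΩ R k
  rcΩ-fromLinearFamily R k K family = (2 * K) ^ k * 2 , K , bound
    where
      bound : ∀ n → K ≤ n → ∃[ L ] (n ^ k ≤ (2 * K) ^ k * 2 * L × rc≥ R n L)
      bound n K≤n with family (n / K) (m≥n⇒m/n>0 K≤n)
      ... | L , m^k≤2L , rc = L , n^k≤cL , rc≥-mono Km≤n rc
        where
          open ≤-Reasoning
          m : ℕ
          m = n / K
          Km≤n : K * m ≤ n
          Km≤n = ≤-trans (≤-reflexive (*-comm K m)) (m/n*n≤m n K)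
          n≤2Km : n ≤ 2 * K * m
          n≤2Km = begin
            n                     ≡⟨ m≡m%n+[m/n]*n n K ⟩
            n % K + m * K         ≤⟨ +-monoˡ-≤ (m * K) (<⇒≤ (m%n<n n K)) ⟩
            K + m * K             ≤⟨ +-mono-≤ (m≤m*n K m {{>-nonZero (m≥n⇒m/n>0 K≤n)}})
                                              (≤-reflexive (*-comm m K)) ⟩
            K * m + K * m         ≡⟨ cong (K * m +_) (sym (+-identityʳ (K * m))) ⟩
            2 * (K * m)           ≡⟨ sym (*-assoc 2 K m) ⟩
            2 * K * m             ∎
          n^k≤cL : n ^ k ≤ (2 * K) ^ k * 2 * L
          n^k≤cL = begin
            n ^ k                 ≤⟨ ^-monoˡ-≤ k n≤2Km ⟩
            (2 * K * m) ^ k       ≡⟨ ^-distribʳ-* (2 * K) m k ⟩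
            (2 * K) ^ k * m ^ k   ≤⟨ *-monoʳ-≤ ((2 * K) ^ k) m^k≤2L ⟩
            (2 * K) ^ k * (2 * L) ≡⟨ sym (*-assoc ((2 * K) ^ k) 2 L) ⟩
            (2 * K) ^ k * 2 * L   ∎

module MultisetCriterion (Sig : Signature) (SM : SafeMapping Sig) (P : Precedence Sig) where
  open Signature Sig
  open Terms Sig
  open SafeMapping SM
  open Precedence P
  open POP Sig SM P

  mulGt-replace : ∀ {_>_ : Term → Term → Set} Ps y Qs Zs →
    All (y >_) Zs → MulGt _>_ (Ps ++ y List.∷ Qs) (Ps ++ Zs)
  mulGt-replace Ps y Qs Zs y>Zs =
    mulGt Ps (y List.∷ Qs) Ps Zs (↭-reflexive refl) (↭-reflexive refl)
      (Pointwise.refl ≈refl) (λ ()) (All.map here y>Zs)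

  module AllNormal (f : Sym) (normal : ∀ i → safe f i ≡ false) where

    normalArgs-all : ∀ ts → normalArgs f ts ≡ toList ts
    normalArgs-all ts = begin
      List.map (lookup ts) (filterᵇ (λ i → not (safe f i)) (allFin (arity f)))
        ≡⟨ cong (List.map (lookup ts))
                (filterᵇ-all _ (λ i → cong not (normal i)) (allFin (arity f))) ⟩
      List.map (lookup ts) (allFin (arity f))
        ≡⟨ map-tabulate (λ i → i) (lookup ts) ⟩
      List.tabulate (lookup ts)
        ≡⟨ tabulate-lookup ts ⟩
      toList ts ∎
      where open ≡-Reasoning

    safeArgs-none : ∀ ts → safeArgs f ts ≡ List.[]
    safeArgs-none ts =
      cong (List.map (lookup ts)) (filterᵇ-none _ normal (allFin (arity f)))

    pop-replace : isDefined f ≡ true → ∀ {ss ts} Ps y Qs Zs →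
      toList ss ≡ Ps ++ y List.∷ Qs → toList ts ≡ Ps ++ Zs →
      All (y >pop*_) Zs → app f ss >pop* app f ts
    pop-replace f-def {ss} {ts} Ps y Qs Zs ss≡ ts≡ y>Zs =
      pop-eq f-def (≿-refl f , ≿-refl f)
        (subst₂ (MulGt _>pop*_) (sym (trans (normalArgs-all ss) ss≡))
                                (sym (trans (normalArgs-all ts) ts≡))
                (mulGt-replace Ps y Qs Zs y>Zs))
        (subst₂ (MulGe _>pop*_) (sym (safeArgs-none ss)) (sym (safeArgs-none ts))
                (mulGe List.[] List.[] List.[] List.[] (↭-reflexive refl)
                       (↭-reflexive refl) Pointwise.[] All.[]))

-- steps d m: the number of rule applications needed to bring d trailing
-- counters, all equal to m, down to 0.  From m+1, the d-1 counters behind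
-- the first one are counted down to 0, then one rule decrements the first
-- counter and resets those behind it, leaving d counters equal to m.
steps : ℕ → ℕ → ℕ
steps zero    m       = 0
steps (suc d) zero    = 0
steps (suc d) (suc m) = steps d (suc m) + suc (steps (suc d) m)

steps-suc : ∀ d m → steps d m ≤ steps d (suc m)
steps-suc zero    m       = z≤n
steps-suc (suc d) zero    = z≤n
steps-suc (suc d) (suc m) =
  ≤-trans (n≤1+n _) (m≤n+m (suc (steps (suc d) (suc m))) (steps d (suc (suc m))))

steps-mono : ∀ d {m m'} → m ≤ m' → steps d m ≤ steps d m'
steps-mono d {m' = zero}   z≤n = ≤-refl
steps-mono d {m' = suc m'} m≤1+m' with m≤n⇒m<n∨m≡n m≤1+m'
... | inj₁ (s≤s m≤m') = ≤-trans (steps-mono d m≤m') (steps-suc d m')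
... | inj₂ refl       = ≤-refl

-- Counting down from y + x passes y times through a phase that counts the
-- inner d counters down from a value ≥ x.
steps-sum : ∀ d y x → y * suc (steps d x) ≤ suc (steps (suc d) (y + x))
steps-sum d zero    x = z≤n
steps-sum d (suc y) x =
  s≤s (+-mono-≤ (steps-mono d (≤-trans (m≤n+m x y) (n≤1+n _))) (steps-sum d y x))

steps-lower : ∀ d m → m ^ d ≤ suc (steps d (2 ^ d * m))
steps-lower zero    m = s≤s z≤n
steps-lower (suc d) m = begin
  m * m ^ d                         ≤⟨ *-monoˡ-≤ (m ^ d) m≤M ⟩
  M * m ^ d                         ≤⟨ *-monoʳ-≤ M (steps-lower d m) ⟩
  M * suc (steps d M)               ≤⟨ steps-sum d M M ⟩
  suc (steps (suc d) (M + M))       ≡⟨ cong (λ z → suc (steps (suc d) z)) M+M≡ ⟩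
  suc (steps (suc d) (2 ^ suc d * m)) ∎
  where
    open ≤-Reasoning
    M = 2 ^ d * m
    m≤M : m ≤ M
    m≤M = m≤n*m m (2 ^ d) {{m^n≢0 2 d}}
    M+M≡ : M + M ≡ 2 ^ suc d * m
    M+M≡ = trans (cong (M +_) (sym (+-identityʳ M))) (sym (*-assoc 2 (2 ^ d) m))

steps-positive : ∀ d → 1 ≤ d → ∀ v → 1 ≤ v → 1 ≤ steps d v
steps-positive (suc d) _ v 1≤v = ≤-trans (m≤n+m 1 (steps d 1)) (steps-mono (suc d) 1≤v)

safeSF : ∀ a (g : SymSF) → Fin (Signature.arity (SigSF a) g) → Bool
safeSF a 𝐟 i = false
safeSF a 𝐬 i = true

safeMappingSF : ∀ a → SafeMapping (SigSF a)
safeMappingSF a = record { safe = safeSF a ; constructorSafe = constructorSafe }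
  where
    constructorSafe : ∀ g i → Signature.isDefined (SigSF a) g ≡ false → safeSF a g i ≡ true
    constructorSafe 𝐬 i _ = refl

precedenceSF : ∀ a → Precedence (SigSF a)
precedenceSF a = record
  { _≿_        = _≡_
  ; ≿-refl     = λ _ → refl
  ; ≿-trans    = trans
  ; admissible = λ f≡g _ → cong (Signature.isDefined (SigSF a)) f≡g
  }

module Construction (a : ℕ) where
  open Terms (SigSF a)
  open POP (SigSF a) (safeMappingSF a) (precedenceSF a)
  open Rewriting (SigSF a)
  open MultisetCriterion (SigSF a) (safeMappingSF a) (precedenceSF a)

  zeroᵗ : Term
  zeroᵗ = app 𝟎 []

  sucᵗ : Term → Term
  sucᵗ t = app 𝐬 (t ∷ [])

  numeral : ℕ → Term
  numeral zero    = zeroᵗ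
  numeral (suc n) = sucᵗ (numeral n)

  -- Arguments (of length k, variables numbered from o) of the two sides of
  -- rule j:  x_o,…,x_{o+j-1}, s(x_{o+j}), 0,…,0   and
  --          x_o,…,x_{o+j-1}, x_{o+j},  x_{o+j},…,x_{o+j}.
  lhsArgs : (k j o : ℕ) → Vec Term k
  lhsArgs zero    j       o = []
  lhsArgs (suc k) zero    o = sucᵗ (var o) ∷ Vec.replicate k zeroᵗ
  lhsArgs (suc k) (suc j) o = var o ∷ lhsArgs k j (suc o)

  rhsArgs : (k j o : ℕ) → Vec Term k
  rhsArgs zero    j       o = []
  rhsArgs (suc k) zero    o = var o ∷ Vec.replicate k (var o)
  rhsArgs (suc k) (suc j) o = var o ∷ rhsArgs k j (suc o)

  OccursIn : ∀ {k} → ℕ → Vec Term k → Set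
  OccursIn {k} x ts = Σ (Fin k) λ i → Occurs x (lookup ts i)

  occurs-replicate : ∀ {x y} k (i : Fin k) →
    Occurs x (lookup (Vec.replicate k (var y)) i) → x ≡ y
  occurs-replicate (suc k) Fin.zero    here = refl
  occurs-replicate (suc k) (Fin.suc i) occ  = occurs-replicate k i occ

  -- Var(rhs) ⊆ Var(lhs): the right side only repeats x_{o+j}.
  rhsArgs-vars : ∀ k j o x → OccursIn x (rhsArgs k j o) → OccursIn x (lhsArgs k j o)
  rhsArgs-vars (suc k) zero    o x (Fin.zero , here) = Fin.zero , below Fin.zero here
  rhsArgs-vars (suc k) zero    o x (Fin.suc i , occ) with occurs-replicate k i occ
  ... | refl = Fin.zero , below Fin.zero here
  rhsArgs-vars (suc k) (suc j) o x (Fin.zero , occ)  = Fin.zero , occ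
  rhsArgs-vars (suc k) (suc j) o x (Fin.suc i , occ) with rhsArgs-vars k j (suc o) x (i , occ)
  ... | i' , occ' = Fin.suc i' , occ'

  rule : ℕ → Rule
  rule j = app 𝐟 (lhsArgs a j 0) ⇒ app 𝐟 (rhsArgs a j 0)
           ∣ (𝐟 , lhsArgs a j 0 , refl , refl)
           ∣ vars
    where
      vars : ∀ x → Occurs x (app 𝐟 (rhsArgs a j 0)) → Occurs x (app 𝐟 (lhsArgs a j 0))
      vars x (below i occ) with rhsArgs-vars a j 0 x (i , occ)
      ... | i' , occ' = below i' occ'

  R : TRS
  R = List.map (λ i → rule (toℕ i)) (allFin a)

  rule∈R : ∀ j → j < a → rule j ∈ R
  rule∈R j j<a = subst (λ z → rule z ∈ R) (toℕ-fromℕ< j<a)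
                   (∈-map⁺ (λ i → rule (toℕ i)) (∈-allFin (fromℕ< j<a)))

  rule-shape : ∀ k j o → j < k → ∃[ Ps ] ∃[ Qs ] ∃[ x ] ∃[ Zs ]
    (toList (lhsArgs k j o) ≡ Ps ++ sucᵗ (var x) List.∷ Qs ×
     toList (rhsArgs k j o) ≡ Ps ++ Zs × All (_≡ var x) Zs)
  rule-shape (suc k) zero o _ =
    List.[] , toList (Vec.replicate k zeroᵗ) , o , List.replicate (suc k) (var o) ,
    refl , toList-replicate (suc k) (var o) , replicate⁺ (suc k) refl
  rule-shape (suc k) (suc j) o (s≤s j<k) with rule-shape k j (suc o) j<k
  ... | Ps , Qs , x , Zs , lhs≡ , rhs≡ , Zs≡x =
    var o List.∷ Ps , Qs , x , Zs , cong (var o List.∷_) lhs≡ , cong (var o List.∷_) rhs≡ , Zs≡x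

  -- Each rule decreases in the multiset case of >pop*, since s(x) >pop* x.
  rule-oriented : ∀ j → j < a → lhs (rule j) >pop* rhs (rule j)
  rule-oriented j j<a with rule-shape a j 0 j<a
  ... | Ps , Qs , x , Zs , lhs≡ , rhs≡ , Zs≡x =
    pop-replace refl Ps (sucᵗ (var x)) Qs Zs lhs≡ rhs≡
      (All.map (λ { refl → pop-sub Fin.zero (inj₂ ≈refl) }) Zs≡x)
    where open AllNormal 𝐟 (λ _ → refl)

  compatible : Compatible R
  compatible ρ∈R with ∈-map⁻ (λ i → rule (toℕ i)) ρ∈R
  ... | i , _ , refl = rule-oriented (toℕ i) (toℕ<n i)

  state : Vec ℕ a → Term
  state vs = app 𝐟 (Vec.map numeral vs)

  fill : ∀ {k} → ℕ → ℕ → Vec ℕ k → Vec ℕ k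
  fill {k} zero    m vs       = Vec.replicate k m
  fill     (suc j) m []       = []
  fill     (suc j) m (v ∷ vs) = v ∷ fill j m vs

  fill-beyond : ∀ {k} j m (vs : Vec ℕ k) → k ≤ j → fill j m vs ≡ vs
  fill-beyond zero    m []       _         = refl
  fill-beyond (suc j) m []       _         = refl
  fill-beyond (suc j) m (v ∷ vs) (s≤s k≤j) = cong (v ∷_) (fill-beyond j m vs k≤j)

  fill-idem : ∀ {k} j m (vs : Vec ℕ k) → fill (suc j) m (fill j m vs) ≡ fill j m vs
  fill-idem zero    m []       = refl
  fill-idem zero    m (v ∷ vs) = refl
  fill-idem (suc j) m []       = refl
  fill-idem (suc j) m (v ∷ vs) = cong (v ∷_) (fill-idem j m vs)

  Matches : ∀ {k} → ℕ → Subst → Vec ℕ k → Set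
  Matches o σ []       = ⊤
  Matches o σ (v ∷ vs) = σ o ≡ numeral v × Matches (suc o) σ vs

  valuation : ∀ {k} → Vec ℕ k → ℕ → ℕ
  valuation []       x       = 0
  valuation (v ∷ vs) zero    = v
  valuation (v ∷ vs) (suc x) = valuation vs x

  matches-shift : ∀ {k} o σ (vs : Vec ℕ k) →
    Matches o (λ x → σ (suc x)) vs → Matches (suc o) σ vs
  matches-shift o σ []       _         = tt
  matches-shift o σ (v ∷ vs) (eq , eqs) = eq , matches-shift (suc o) σ vs eqs

  matches-valuation : ∀ {k} (vs : Vec ℕ k) → Matches 0 (λ x → numeral (valuation vs x)) vs
  matches-valuation []       = tt
  matches-valuation (v ∷ vs) = refl , matches-shift 0 _ vs (matches-valuation vs)

  replicate-instance : ∀ k σ (t : Term) n → t ⟨ σ ⟩ ≡ numeral n →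
    Vec.replicate k t ⟨ σ ⟩* ≡ Vec.map numeral (Vec.replicate k n)
  replicate-instance zero    σ t n eq = refl
  replicate-instance (suc k) σ t n eq = cong₂ _∷_ eq (replicate-instance k σ t n eq)

  -- Under a matching substitution, the sides of rule j become the states
  -- before and after one decrement of counter j.
  lhs-instance : ∀ {k} j o σ m (vs : Vec ℕ k) → Matches o σ (fill j m vs) →
    lhsArgs k j o ⟨ σ ⟩* ≡ Vec.map numeral (fill (suc j) 0 (fill j (suc m) vs))
  lhs-instance zero    o σ m []       _          = refl
  lhs-instance zero    o σ m (v ∷ vs) (eq , _)   =
    cong₂ _∷_ (cong sucᵗ eq) (replicate-instance _ σ zeroᵗ 0 refl)
  lhs-instance (suc j) o σ m []       _          = refl
  lhs-instance (suc j) o σ m (v ∷ vs) (eq , eqs) = cong₂ _∷_ eq (lhs-instance j (suc o) σ m vs eqs)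

  rhs-instance : ∀ {k} j o σ m (vs : Vec ℕ k) → Matches o σ (fill j m vs) →
    rhsArgs k j o ⟨ σ ⟩* ≡ Vec.map numeral (fill j m vs)
  rhs-instance zero    o σ m []       _          = refl
  rhs-instance zero    o σ m (v ∷ vs) (eq , _)   = cong₂ _∷_ eq (replicate-instance _ σ (var o) m eq)
  rhs-instance (suc j) o σ m []       _          = refl
  rhs-instance (suc j) o σ m (v ∷ vs) (eq , eqs) = cong₂ _∷_ eq (rhs-instance j (suc o) σ m vs eqs)

  numeral-constr : ∀ n → ConstrTerm (numeral n)
  numeral-constr zero    = capp refl (λ ())
  numeral-constr (suc n) = capp refl (λ { Fin.zero → numeral-constr n })

  numerals-constr : ∀ {k} (vs : Vec ℕ k) (i : Fin k) → ConstrTerm (lookup (Vec.map numeral vs) i)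
  numerals-constr (v ∷ vs) Fin.zero    = numeral-constr v
  numerals-constr (v ∷ vs) (Fin.suc i) = numerals-constr vs i

  -- Rule j decrements counter j from m+1 to m and resets the counters behind
  -- it from 0 to m; the redex has numeral (hence normal) arguments.
  decrement : ∀ j m (vs : Vec ℕ a) → j < a →
    _⟶ᵢ_ R (state (fill (suc j) 0 (fill j (suc m) vs))) (state (fill j m vs))
  decrement j m vs j<a =
    subst₂ (_⟶ᵢ_ R) (cong (app 𝐟) lhs≡) (cong (app 𝐟) rhs≡)
      (root σ (rule∈R j j<a)
        (subst (λ ts → ∀ i → NF R (lookup ts i)) (sym lhs≡)
          (λ i → constr-NF R (numerals-constr (fill (suc j) 0 (fill j (suc m) vs)) i))))
    where
      σ : Subst
      σ x = numeral (valuation (fill j m vs) x)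
      lhs≡ : lhsArgs a j 0 ⟨ σ ⟩* ≡ Vec.map numeral (fill (suc j) 0 (fill j (suc m) vs))
      lhs≡ = lhs-instance j 0 σ m vs (matches-valuation _)
      rhs≡ : rhsArgs a j 0 ⟨ σ ⟩* ≡ Vec.map numeral (fill j m vs)
      rhs≡ = rhs-instance j 0 σ m vs (matches-valuation _)

  countdown : ∀ d m j (vs : Vec ℕ a) → j + d ≡ a →
    InnermostSeq R (steps d m) (state (fill j m vs)) (state (fill j 0 vs))
  countdown zero m j vs j≡a =
    subst₂ (InnermostSeq R 0) (cong state (sym (fill-beyond j m vs a≤j)))
                              (cong state (sym (fill-beyond j 0 vs a≤j))) done
    where
      a≤j : a ≤ j
      a≤j = ≤-reflexive (trans (sym j≡a) (+-identityʳ j))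
  countdown (suc d) zero    j vs j+d≡a = done
  countdown (suc d) (suc m) j vs j+d≡a =
    subst (λ ws → InnermostSeq R (steps d (suc m)) (state ws)
                  (state (fill (suc j) 0 (fill j (suc m) vs)))) (fill-idem j (suc m) vs)
          (countdown d (suc m) (suc j) (fill j (suc m) vs) (trans (sym (+-suc j d)) j+d≡a))
    ++ˢ step (decrement j m vs j<a) (countdown (suc d) m j vs j+d≡a)
    where
      j<a : j < a
      j<a = ≤-trans (s≤s (m≤m+n j d)) (≤-reflexive (trans (sym (+-suc j d)) j+d≡a))

  size-numeral : ∀ v → size (numeral v) ≡ suc v
  size-numeral zero    = refl
  size-numeral (suc v) = cong suc (trans (+-identityʳ _) (size-numeral v))

  size-uniform : ∀ v → size (state (Vec.replicate a v)) ≡ suc (a * suc v)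
  size-uniform v = cong suc (sizes-numerals a)
    where
      sizes-numerals : ∀ k → sizes (Vec.map numeral (Vec.replicate k v)) ≡ k * suc v
      sizes-numerals zero    = refl
      sizes-numerals (suc k) = cong₂ _+_ (size-numeral v) (sizes-numerals k)

  -- The linear-size family: f(v,…,v) with v = 2^a·m has size ≤ K·m and
  -- starts an innermost derivation of length steps a v ≥ m^a / 2.
  K : ℕ
  K = suc a * suc (2 ^ a)

  long-derivations : 1 ≤ a → ∀ m → 1 ≤ m → ∃[ L ] (m ^ a ≤ 2 * L × rc≥ R (K * m) L)
  long-derivations 1≤a m 1≤m =
    L , m^a≤2L ,
    state (Vec.replicate a v) , basic refl (numerals-constr (Vec.replicate a v)) , size≤Km ,
    _ , countdown a v 0 (Vec.replicate a 0) refl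
    where
      open ≤-Reasoning
      v L : ℕ
      v = 2 ^ a * m
      L = steps a v
      1≤L : 1 ≤ L
      1≤L = steps-positive a 1≤a v (≤-trans 1≤m (m≤n*m m (2 ^ a) {{m^n≢0 2 a}}))
      m^a≤2L : m ^ a ≤ 2 * L
      m^a≤2L = begin
        m ^ a          ≤⟨ steps-lower a m ⟩
        1 + L          ≤⟨ +-monoˡ-≤ L 1≤L ⟩
        L + L          ≡⟨ cong (L +_) (sym (+-identityʳ L)) ⟩
        2 * L          ∎
      size≤Km : size (state (Vec.replicate a v)) ≤ K * m
      size≤Km = begin
        size (state (Vec.replicate a v)) ≡⟨ size-uniform v ⟩
        1 + a * suc v                    ≤⟨ +-monoˡ-≤ (a * suc v) (s≤s z≤n) ⟩
        suc v + a * suc v                ≡⟨⟩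
        suc a * suc v                    ≤⟨ *-monoʳ-≤ (suc a) (+-monoˡ-≤ v 1≤m) ⟩
        suc a * (suc (2 ^ a) * m)        ≡⟨ sym (*-assoc (suc a) (suc (2 ^ a)) m) ⟩
        K * m                            ∎

lemma3p14 : ∀ (k : ℕ) → 1 ≤ k →
    ∃[ a ] Σ (Terms.TRS (SigSF a)) λ R →
      (Σ (SafeMapping (SigSF a)) λ SM → Σ (Precedence (SigSF a)) λ P →
         POP.Compatible (SigSF a) SM P R)
      × Terms.rcΩ (SigSF a) R k
lemma3p14 k 1≤k =
  k , R , (safeMappingSF k , precedenceSF k , compatible) ,
  Rewriting.rcΩ-fromLinearFamily (SigSF k) R k K (long-derivations 1≤k)
  where open Construction k
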